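{- Let $I=(E,\mathcal{M},c,p,B,k,\ell)$ be a BM instance, $0<\varepsilon<\frac12$, $\frac{\mathrm{OPT}(I)}{2\ell}\le\alpha\le\mathrm{OPT}(I)$, and $R\subseteq E$. If for every $r\in D(I,\varepsilon)$ the set $R\cap\mathcal{K}_r(\alpha)$ is an exchange set for $I,\varepsilon,\alpha$ and $r$, then $R$ is a representative set of $I$ and $\varepsilon$.
   Context: A matroid is a pair $(E,\mathcal{I})$ with $E$ finite, $\mathcal{I}\subseteq 2^E$, $\emptyset\in\mathcal{I}$, $\mathcal{I}$ closed under subsets, and satisfying the exchange property. For $\ell\ge 1$, an $\ell$-matchoid on $E$ is a collection $\mathcal{M}=\{(E_i,\mathcal{I}_i)\}_{i\in[s]}$ of matroids with $E_i\subseteq E$ such that every $e\in E$ lies in at most $\ell$ of the sets $E_i$; $S\subseteq E$ is feasible if $S\cap E_i\in\mathcal{I}_i$ for all $i$, and $\mathcal{M}_k$ is the set of feasible sets of cardinality at most $k$. A BM instance is $I=(E,\mathcal{M},c,p,B,k,\ell)$ with $\mathcal{M}$ an $\ell$-matchoid on $E$, $c,p:E\to\mathbb{N}_{>0}$, $B\in\mathbb{N}_{>0}$, $k,\ell\in\mathbb{N}_{>0}$. A solution is $S\in\mathcal{M}_k$ with $c(S)\le B$ (where $f(S)=\sum_{e\in S}f(e)$); $\mathrm{OPT}(I)$ is the maximum of $p(S)$ over solutions. A set $R\subseteq E$ is a representative set of $I$ and $\varepsilon$ if there is a solution $S$ of $I$ with $S\subseteq R$ and $p(S)\ge(1-2\varepsilon)\mathrm{OPT}(I)$.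 Let $D(I,\varepsilon)=\{r\in\mathbb{N}_{>0}: (1-\varepsilon)^{r-1}\ge\frac{\varepsilon}{2\ell k}\}$ and for $r\in D(I,\varepsilon)$ let $\mathcal{K}_r(\alpha)=\{e\in E:\frac{p(e)}{2\ell\alpha}\in((1-\varepsilon)^r,(1-\varepsilon)^{r-1}]\}$. A set $X\subseteq\mathcal{K}_r(\alpha)$ is an exchange set for $I,\varepsilon,\alpha,r$ if for every $\Delta\in\mathcal{M}_k$ and every $a\in(\Delta\cap\mathcal{K}_r(\alpha))\setminus X$ there is $b\in(\mathcal{K}_r(\alpha)\cap X)\setminus\Delta$ with $c(b)\le c(a)$ and $(\Delta\setminus\{a\})\cup\{b\}\in\mathcal{M}_k$.
   Formalization: The parameters ε and α range over the rationals. -}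

module Defs where

open import Data.Nat as ℕ using (ℕ; zero; suc; _+_; _≤_; _<_)
open import Data.Bool using (true; false; if_then_else_)
open import Data.Fin using (Fin)
import Data.Fin as Fin
open import Data.Fin.Subset using (Subset; _∈_; _∉_; _⊆_; _∩_; _∪_; _─_; ⁅_⁆; ⊥; ∣_∣) renaming (_-_ to _∖_)
open import Data.Fin.Subset.Properties using (_∈?_)
open import Data.Vec using (Vec; []; _∷_; tabulate)
open import Data.Product using (Σ; _×_; ∃; ∃-syntax; _,_)
open import Relation.Nullary using (¬_; does)
open import Data.Integer using (+_)
open import Data.Rational as ℚ using (ℚ; _<_; _≤_; 1ℚ; 0ℚ; _*_; _-_)

wsum : ∀ {n} → Subset n → (Fin n → ℕ) → ℕ
wsum [] f = 0
wsum (b ∷ S) f = (if b then f Fin.zero else 0) + wsum S (λ i → f (Fin.suc i))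

toℚ : ℕ → ℚ
toℚ m = (+ m) ℚ./ 1

_^ℚ_ : ℚ → ℕ → ℚ
q ^ℚ zero = 1ℚ
q ^ℚ suc m = q * (q ^ℚ m)

record Matroid (n : ℕ) : Set₁ where
  field
    ground   : Subset n
    Indep    : Subset n → Set
    indep⊆   : ∀ {A} → Indep A → A ⊆ ground
    indep-∅  : Indep ⊥
    indep-↓  : ∀ {A B} → A ⊆ B → Indep B → Indep A
    exchange : ∀ {A B} → Indep A → Indep B → ∣ A ∣ ℕ.< ∣ B ∣ →
               ∃[ x ] (x ∈ B × x ∉ A × Indep (A ∪ ⁅ x ⁆))

-- An ℓ-matchoid on E = Fin n: s matroids, each e in at most ℓ ground sets
record Matchoid (n ℓ : ℕ) : Set₁ where
  field
    s        : ℕ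
    mat      : Fin s → Matroid n
    bounded  : ∀ (e : Fin n) →
               ∣ tabulate (λ i → does (e ∈? Matroid.ground (mat i))) ∣ ℕ.≤ ℓ

  Feasible : Subset n → Set
  Feasible S = ∀ i → Matroid.Indep (mat i) (S ∩ Matroid.ground (mat i))

record BM (n : ℕ) : Set₁ where
  field
    k ℓ   : ℕ
    M     : Matchoid n ℓ
    c p   : Fin n → ℕ
    B     : ℕ
    c-pos : ∀ e → 0 ℕ.< c e
    p-pos : ∀ e → 0 ℕ.< p e
    B-pos : 0 ℕ.< B
    k-pos : 0 ℕ.< k
    ℓ-pos : 0 ℕ.< ℓ

  InMk : Subset n → Set
  InMk S = Matchoid.Feasible M S × ∣ S ∣ ℕ.≤ k

  IsSolution : Subset n → Set
  IsSolution S = InMk S × wsum S c ℕ.≤ B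

  IsOPT : ℕ → Set
  IsOPT o = (∃[ S ] (IsSolution S × wsum S p ≡ℕ o)) × (∀ S → IsSolution S → wsum S p ℕ.≤ o)
    where
      open import Relation.Binary.PropositionalEquality using () renaming (_≡_ to _≡ℕ_)

  IsRepresentative : ℕ → ℚ → Subset n → Set
  IsRepresentative o ε R =
    ∃[ S ] (IsSolution S × S ⊆ R × ((1ℚ - (toℚ 2 * ε)) * toℚ o) ℚ.≤ toℚ (wsum S p))

  -- r ∈ D(I, ε) :  (1-ε)^(r-1) ≥ ε / (2ℓk), written as ε ≤ 2ℓk·(1-ε)^(r-1)
  InD : ℚ → ℕ → Set
  InD ε r = (0 ℕ.< r) × (ε ℚ.≤ (toℚ (2 ℕ.* ℓ ℕ.* k) * ((1ℚ - ε) ^ℚ (r ℕ.∸ 1))))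

  -- e ∈ K_r(α) : p(e)/(2ℓα) ∈ ((1-ε)^r, (1-ε)^(r-1)], cleared of the denominator 2ℓα
  InK : ℚ → ℚ → ℕ → Fin n → Set
  InK ε α r e =
    (((1ℚ - ε) ^ℚ r) * (toℚ (2 ℕ.* ℓ) * α) ℚ.< toℚ (p e)) ×
    (toℚ (p e) ℚ.≤ ((1ℚ - ε) ^ℚ (r ℕ.∸ 1)) * (toℚ (2 ℕ.* ℓ) * α))

  IsExchangeSet : ℚ → ℚ → ℕ → (Fin n → Set) → Set
  IsExchangeSet ε α r X =
    (∀ e → X e → InK ε α r e) ×
    (∀ Δ → InMk Δ → ∀ a → a ∈ Δ → InK ε α r a → ¬ X a →
      ∃[ b ] (InK ε α r b × X b × b ∉ Δ × c b ℕ.≤ c a × InMk ((Δ ∖ a) ∪ ⁅ b ⁆)))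

module Submission where

-- Start from an optimal solution S*. Call e ∉ R big when k·p(e) > εα. The elements of S* that
-- are neither in R nor big have p(e) ≤ εα/k, so, as |S*| ≤ k, they weigh at most εα ≤ ε·OPT.
-- A big element a of a solution Δ lies in a class K_r(α) with r ∈ D(I,ε), so the exchange
-- property replaces it by some b ∈ R ∩ K_r(α) with c(b) ≤ c(a); as a and b lie in the same
-- class, p(b) > (1-ε)·p(a). Hence Φ(Δ) = p(Δ ∩ R) + (1-ε)·p(big part of Δ) never decreases
-- while the big part shrinks. Once it is empty, Δ ∩ R is a solution inside R of value
-- Φ(Δ) ≥ Φ(S*) = p(S* ∩ R) + (1-ε)·p(big part of S*) ≥ (1-2ε)·OPT.

open import Defs
open import Level using (0ℓ)
open import Data.Nat using (ℕ; zero; suc; z≤n; s≤s; z<s)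
import Data.Nat as ℕ
import Data.Nat.Properties as ℕ
open import Data.Nat.Induction using (<-rec)
open import Data.Nat.Coprimality using (1-coprimeTo) renaming (sym to coprime-sym)
open import Data.Integer as ℤ using (+_; +[1+_]; -[1+_]; +≤+; +<+)
import Data.Integer.Properties as ℤ
open import Data.Bool using (true; false; if_then_else_)
open import Data.Fin using (Fin)
import Data.Fin as Fin
open import Data.Fin.Subset using (Subset; _∈_; _∉_; _⊆_; _∩_; _∪_; ⁅_⁆; ∣_∣) renaming (_-_ to _∖_)
open import Data.Fin.Subset.Properties
  using (_∈?_; drop-∷-⊆; drop-not-there; p─⊥≡p; ∪-identityʳ; p─q⊆p; x∈p∩q⁺; x∈p∩q⁻; p⊆q⇒∣p∣≤∣q∣; p∩q⊆p; p∩q⊆q)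
open import Data.Vec using ([]; _∷_; here; there)
open import Data.Rational as ℚ
  using (ℚ; mkℚ; toℚᵘ; _+_; _*_; _-_; -_; _≤_; _<_; 0ℚ; 1ℚ; ½; *<*; nonNegative; positive)
open import Data.Rational.Properties
import Data.Rational.Unnormalised as ℚᵘ
import Data.Rational.Unnormalised.Properties as ℚᵘ
open import Data.Rational.Solver using (module +-*-Solver)
open import Data.Product using (∃; _×_; _,_; proj₁; proj₂)
open import Data.Empty using (⊥-elim)
open import Function using (_∘_)
open import Algebra.Properties.CommutativeSemigroup ℕ.+-commutativeSemigroup using (interchange)
open import Relation.Nullary using (¬_; does; yes; no; contradiction)
open import Relation.Nullary.Decidable using (dec-true; dec-false)
open import Relation.Unary using (Pred; Decidable)
open import Relation.Unary.Properties using (∁?)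
open import Relation.Binary.PropositionalEquality

toℚᵘ-toℚ : ∀ m → toℚᵘ (toℚ m) ≡ ℚᵘ.mkℚᵘ (+ m) 0
toℚᵘ-toℚ m = cong toℚᵘ (normalize-coprime (coprime-sym (1-coprimeTo m)))

toℚ-homo-via : ∀ (_∙ᵘ_ : ℚᵘ.ℚᵘ → ℚᵘ.ℚᵘ → ℚᵘ.ℚᵘ) (_∙_ : ℚ → ℚ → ℚ) →
  (∀ p q → toℚᵘ (p ∙ q) ℚᵘ.≃ (toℚᵘ p ∙ᵘ toℚᵘ q)) → ∀ k m n →
  ℚᵘ.mkℚᵘ (+ k) 0 ℚᵘ.≃ (ℚᵘ.mkℚᵘ (+ m) 0 ∙ᵘ ℚᵘ.mkℚᵘ (+ n) 0) →
  toℚ k ≡ toℚ m ∙ toℚ n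
toℚ-homo-via _∙ᵘ_ _∙_ homo k m n k≃m∙n = toℚᵘ-injective (begin
  toℚᵘ (toℚ k)                        ≡⟨ toℚᵘ-toℚ k ⟩
  ℚᵘ.mkℚᵘ (+ k) 0                     ≈⟨ k≃m∙n ⟩
  ℚᵘ.mkℚᵘ (+ m) 0 ∙ᵘ ℚᵘ.mkℚᵘ (+ n) 0  ≡⟨ cong₂ _∙ᵘ_ (toℚᵘ-toℚ m) (toℚᵘ-toℚ n) ⟨
  toℚᵘ (toℚ m) ∙ᵘ toℚᵘ (toℚ n)        ≈⟨ homo (toℚ m) (toℚ n) ⟨
  toℚᵘ (toℚ m ∙ toℚ n)                ∎)
  where open ℚᵘ.≃-Reasoning

toℚ-+ : ∀ m n → toℚ (m ℕ.+ n) ≡ toℚ m + toℚ n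
toℚ-+ m n = toℚ-homo-via ℚᵘ._+_ _+_ toℚᵘ-homo-+ (m ℕ.+ n) m n (ℚᵘ.*≡* (begin
  + (m ℕ.+ n) ℤ.* + 1                    ≡⟨ ℤ.*-identityʳ _ ⟩
  + (m ℕ.+ n)                            ≡⟨ ℤ.pos-+ m n ⟩
  + m ℤ.+ + n                            ≡⟨ cong₂ ℤ._+_ (ℤ.*-identityʳ (+ m)) (ℤ.*-identityʳ (+ n)) ⟨
  + m ℤ.* + 1 ℤ.+ + n ℤ.* + 1            ≡⟨ ℤ.*-identityʳ _ ⟨
  (+ m ℤ.* + 1 ℤ.+ + n ℤ.* + 1) ℤ.* + 1  ∎))
  where open ≡-Reasoning

toℚ-* : ∀ m n → toℚ (m ℕ.* n) ≡ toℚ m * toℚ n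
toℚ-* m n = toℚ-homo-via ℚᵘ._*_ _*_ toℚᵘ-homo-* (m ℕ.* n) m n (ℚᵘ.*≡* (begin
  + (m ℕ.* n) ℤ.* + 1        ≡⟨ ℤ.*-identityʳ _ ⟩
  + (m ℕ.* n)                ≡⟨ ℤ.pos-* m n ⟩
  + m ℤ.* + n                ≡⟨ ℤ.*-identityʳ _ ⟨
  (+ m ℤ.* + n) ℤ.* + 1      ∎))
  where open ≡-Reasoning

toℚ-mono-≤ : ∀ {m n} → m ℕ.≤ n → toℚ m ≤ toℚ n
toℚ-mono-≤ {m} {n} m≤n = toℚᵘ-cancel-≤ (subst₂ ℚᵘ._≤_ (sym (toℚᵘ-toℚ m)) (sym (toℚᵘ-toℚ n))
  (ℚᵘ.*≤* (subst₂ ℤ._≤_ (sym (ℤ.*-identityʳ (+ m))) (sym (ℤ.*-identityʳ (+ n))) (+≤+ m≤n))))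

toℚ-mono-< : ∀ {m n} → m ℕ.< n → toℚ m < toℚ n
toℚ-mono-< {m} {n} m<n = toℚᵘ-cancel-< (subst₂ ℚᵘ._<_ (sym (toℚᵘ-toℚ m)) (sym (toℚᵘ-toℚ n))
  (ℚᵘ.*<* (subst₂ ℤ._<_ (sym (ℤ.*-identityʳ (+ m))) (sym (ℤ.*-identityʳ (+ n))) (+<+ m<n))))

toℚ-nonNeg : ∀ m → 0ℚ ≤ toℚ m
toℚ-nonNeg m = toℚ-mono-≤ {0} {m} z≤n

p≤p+q : ∀ p {q} → 0ℚ ≤ q → p ≤ p + q
p≤p+q p {q} 0≤q = subst (_≤ p + q) (+-identityʳ p) (+-monoʳ-≤ p 0≤q)

nonNeg*nonNeg : ∀ {p q} → 0ℚ ≤ p → 0ℚ ≤ q → 0ℚ ≤ p * q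
nonNeg*nonNeg {p} {q} 0≤p 0≤q =
  nonNegative⁻¹ (p * q) {{nonNeg*nonNeg⇒nonNeg p {{nonNegative 0≤p}} q {{nonNegative 0≤q}}}}

nonNeg+nonNeg : ∀ {p q} → 0ℚ ≤ p → 0ℚ ≤ q → 0ℚ ≤ p + q
nonNeg+nonNeg = +-mono-≤

p<1+p : ∀ p → p < 1ℚ + p
p<1+p p = subst (_< 1ℚ + p) (+-identityˡ p) (+-monoˡ-< p (toℚ-mono-< {0} {1} (s≤s z≤n)))

p<1⇒0<1-p : ∀ {p} → p < 1ℚ → 0ℚ < 1ℚ - p
p<1⇒0<1-p {p} p<1 = subst (_< 1ℚ - p) (+-inverseʳ p) (+-monoˡ-< (- p) p<1)

½<1 : ½ < 1ℚ
½<1 = *<* (+<+ (s≤s (s≤s z≤n)))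

a+q[b+x]≤[a+y]+qb : ∀ a b q {x y} → q * x ≤ y → a + q * (b + x) ≤ (a + y) + q * b
a+q[b+x]≤[a+y]+qb a b q {x} {y} qx≤y = begin
  a + q * (b + x)      ≡⟨ regroup a b q x ⟩
  (a + q * b) + q * x  ≤⟨ +-monoʳ-≤ (a + q * b) qx≤y ⟩
  (a + q * b) + y      ≡⟨ swap a (q * b) y ⟩
  (a + y) + q * b      ∎
  where
  open ≤-Reasoning
  open +-*-Solver
  regroup : ∀ a b q x → a + q * (b + x) ≡ (a + q * b) + q * x
  regroup = solve 4 (λ a b q x → a :+ q :* (b :+ x) := (a :+ q :* b) :+ q :* x) refl
  swap : ∀ a u y → (a + u) + y ≡ (a + y) + u
  swap = solve 3 (λ a u y → (a :+ u) :+ y := (a :+ y) :+ u) refl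

[1-2ε][A+B+C]≤A+[1-ε]B : ∀ {ε A B C} → 0ℚ ≤ ε → 0ℚ ≤ A → 0ℚ ≤ C → C ≤ ε * (A + B + C) →
                          (1ℚ - toℚ 2 * ε) * (A + B + C) ≤ A + (1ℚ - ε) * B
[1-2ε][A+B+C]≤A+[1-ε]B {ε} {A} {B} {C} 0≤ε 0≤A 0≤C C≤εo = begin
  (1ℚ - toℚ 2 * ε) * o                                ≤⟨ p≤p+q _ slack-nonNeg ⟩
  (1ℚ - toℚ 2 * ε) * o + (ε * (A + C) + (ε * o - C))  ≡⟨ expand ε A B C ⟩
  A + (1ℚ - ε) * B                                    ∎
  where
  open ≤-Reasoning
  open +-*-Solver
  o = A + B + C
  slack-nonNeg : 0ℚ ≤ ε * (A + C) + (ε * o - C)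
  slack-nonNeg = nonNeg+nonNeg (nonNeg*nonNeg 0≤ε (nonNeg+nonNeg 0≤A 0≤C))
                               (subst (_≤ ε * o - C) (+-inverseʳ C) (+-monoˡ-≤ (- C) C≤εo))
  expand : ∀ ε A B C → (1ℚ - toℚ 2 * ε) * (A + B + C) + (ε * (A + C) + (ε * (A + B + C) - C)) ≡ A + (1ℚ - ε) * B
  expand = solve 4 (λ e a b c → (con 1ℚ :- con (toℚ 2) :* e) :* (a :+ b :+ c) :+ (e :* (a :+ c) :+ (e :* (a :+ b :+ c) :- c))
                              := a :+ (con 1ℚ :- e) :* b) refl

^ℚ-nonNeg : ∀ {q} n → 0ℚ ≤ q → 0ℚ ≤ q ^ℚ n
^ℚ-nonNeg zero    0≤q = toℚ-nonNeg 1
^ℚ-nonNeg (suc n) 0≤q = nonNeg*nonNeg 0≤q (^ℚ-nonNeg n 0≤q)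

^ℚ-pos : ∀ {q} n → 0ℚ < q → 0ℚ < q ^ℚ n
^ℚ-pos zero    0<q = toℚ-mono-< {0} {1} (s≤s z≤n)
^ℚ-pos {q} (suc n) 0<q =
  positive⁻¹ (q * q ^ℚ n) {{pos*pos⇒pos q {{positive 0<q}} (q ^ℚ n) {{positive (^ℚ-pos n 0<q)}}}}

-- Bernoulli's inequality in the division-free form (1 - ε)ⁿ ≤ 1 / (1 + nε).
[1-ε]^n*[1+nε]≤1 : ∀ {ε} n → 0ℚ ≤ ε → 0ℚ ≤ 1ℚ - ε → ((1ℚ - ε) ^ℚ n) * (1ℚ + toℚ n * ε) ≤ 1ℚ
[1-ε]^n*[1+nε]≤1 {ε} zero _ _ =
  ≤-reflexive (solve 1 (λ e → con 1ℚ :* (con 1ℚ :+ con 0ℚ :* e) := con 1ℚ) refl ε)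
  where open +-*-Solver
[1-ε]^n*[1+nε]≤1 {ε} (suc n) 0≤ε 0≤1-ε = begin
  ((1ℚ - ε) * Q) * (1ℚ + toℚ (suc n) * ε)  ≡⟨ cong (λ z → ((1ℚ - ε) * Q) * (1ℚ + z * ε)) (toℚ-+ 1 n) ⟩
  ((1ℚ - ε) * Q) * (1ℚ + (1ℚ + m) * ε)     ≡⟨ regroup ε Q m ⟩
  Q * ((1ℚ - ε) * (1ℚ + (1ℚ + m) * ε))     ≤⟨ *-monoˡ-≤-nonNeg Q {{nonNegative (^ℚ-nonNeg n 0≤1-ε)}} one-step ⟩
  Q * (1ℚ + m * ε)                         ≤⟨ [1-ε]^n*[1+nε]≤1 n 0≤ε 0≤1-ε ⟩
  1ℚ                                       ∎
  where
  open ≤-Reasoning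
  open +-*-Solver
  Q = (1ℚ - ε) ^ℚ n
  m = toℚ n
  regroup : ∀ ε Q m → ((1ℚ - ε) * Q) * (1ℚ + (1ℚ + m) * ε) ≡ Q * ((1ℚ - ε) * (1ℚ + (1ℚ + m) * ε))
  regroup = solve 3 (λ e q m → ((con 1ℚ :- e) :* q) :* (con 1ℚ :+ (con 1ℚ :+ m) :* e)
                             := q :* ((con 1ℚ :- e) :* (con 1ℚ :+ (con 1ℚ :+ m) :* e))) refl
  expand : ∀ ε m → (1ℚ - ε) * (1ℚ + (1ℚ + m) * ε) + ((1ℚ + m) * ε) * ε ≡ 1ℚ + m * ε
  expand = solve 2 (λ e m → (con 1ℚ :- e) :* (con 1ℚ :+ (con 1ℚ :+ m) :* e) :+ ((con 1ℚ :+ m) :* e) :* e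
                          := con 1ℚ :+ m :* e) refl
  0≤1+m : 0ℚ ≤ 1ℚ + m
  0≤1+m = subst (0ℚ ≤_) (toℚ-+ 1 n) (toℚ-nonNeg (suc n))
  one-step : (1ℚ - ε) * (1ℚ + (1ℚ + m) * ε) ≤ 1ℚ + m * ε
  one-step = subst ((1ℚ - ε) * (1ℚ + (1ℚ + m) * ε) ≤_) (expand ε m)
    (p≤p+q ((1ℚ - ε) * (1ℚ + (1ℚ + m) * ε)) (nonNeg*nonNeg (nonNeg*nonNeg 0≤1+m 0≤ε) 0≤ε))

-- For ε = (1 + a) / (1 + d) the denominator 1 + d is a witness.
archimedean : ∀ {ε} → 0ℚ < ε → ∃ λ m → 1ℚ ≤ toℚ m * ε
archimedean {ε@(mkℚ +[1+ a ] d _)} _ = suc d , toℚᵘ-cancel-≤ (begin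
  ℚᵘ.mkℚᵘ (+ 1) 0                              ≤⟨ ℚᵘ.*≤* (+≤+ d+1≤[d+1][a+1]) ⟩
  ℚᵘ.mkℚᵘ (+ suc d) 0 ℚᵘ.* ℚᵘ.mkℚᵘ +[1+ a ] d  ≡⟨ cong (ℚᵘ._* toℚᵘ ε) (toℚᵘ-toℚ (suc d)) ⟨
  toℚᵘ (toℚ (suc d)) ℚᵘ.* toℚᵘ ε               ≃⟨ toℚᵘ-homo-* (toℚ (suc d)) ε ⟨
  toℚᵘ (toℚ (suc d) * ε)                       ∎)
  where
  open ℚᵘ.≤-Reasoning
  d+1≤[d+1][a+1] : 1 ℕ.* suc (d ℕ.+ 0) ℕ.≤ suc d ℕ.* suc a ℕ.* 1
  d+1≤[d+1][a+1] = subst₂ ℕ._≤_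
    (trans (cong suc (sym (ℕ.+-identityʳ d))) (sym (ℕ.*-identityˡ _))) (sym (ℕ.*-identityʳ _))
    (ℕ.m≤m*n (suc d) (suc a))
archimedean {mkℚ (+ 0) _ _} (*<* (+<+ ()))
archimedean {mkℚ -[1+ _ ] _ _} (*<* ())

∃[1-ε]^n*x<1 : ∀ {ε x} K → 0ℚ < ε → 0ℚ < 1ℚ - ε → x ≤ toℚ K → ∃ λ n → ((1ℚ - ε) ^ℚ n) * x < 1ℚ
∃[1-ε]^n*x<1 {ε} {x} K 0<ε 0<1-ε x≤K with archimedean 0<ε
... | m , 1≤mε = n , (begin-strict
  Q * x                 ≤⟨ *-monoˡ-≤-nonNeg Q {{nonNegative (<⇒≤ 0<Q)}} x≤nε ⟩
  Q * (toℚ n * ε)       <⟨ *-monoʳ-<-pos Q {{positive 0<Q}} (p<1+p (toℚ n * ε)) ⟩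
  Q * (1ℚ + toℚ n * ε)  ≤⟨ [1-ε]^n*[1+nε]≤1 n (<⇒≤ 0<ε) (<⇒≤ 0<1-ε) ⟩
  1ℚ                    ∎)
  where
  open ≤-Reasoning
  n = K ℕ.* m
  Q = (1ℚ - ε) ^ℚ n
  0<Q : 0ℚ < Q
  0<Q = ^ℚ-pos n 0<1-ε
  x≤nε : x ≤ toℚ n * ε
  x≤nε = begin
    x                    ≤⟨ x≤K ⟩
    toℚ K                ≡⟨ *-identityʳ (toℚ K) ⟨
    toℚ K * 1ℚ           ≤⟨ *-monoˡ-≤-nonNeg (toℚ K) {{nonNegative (toℚ-nonNeg K)}} 1≤mε ⟩
    toℚ K * (toℚ m * ε)  ≡⟨ *-assoc (toℚ K) (toℚ m) ε ⟨
    toℚ K * toℚ m * ε    ≡⟨ cong (_* ε) (toℚ-* K m) ⟨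
    toℚ n * ε            ∎

power-bracket : ∀ q {L x} n → (q ^ℚ n) * L < x → x ≤ L →
                ∃ λ r → (q ^ℚ suc r) * L < x × x ≤ (q ^ℚ r) * L
power-bracket q {L} {x} zero    L<x x≤L =
  ⊥-elim (<-irrefl refl (<-≤-trans (subst (_< x) (*-identityˡ L) L<x) x≤L))
power-bracket q {L} {x} (suc n) q¹⁺ⁿL<x x≤L with x ≤? (q ^ℚ n) * L
... | yes x≤qⁿL = n , q¹⁺ⁿL<x , x≤qⁿL
... | no  x≰qⁿL = power-bracket q n (≰⇒> x≰qⁿL) x≤L

restrict : ∀ {n} {P : Pred (Fin n) 0ℓ} → Decidable P → (Fin n → ℕ) → Fin n → ℕ
restrict P? f e = if does (P? e) then f e else 0

module _ {n} {P : Pred (Fin n) 0ℓ} (P? : Decidable P) (f : Fin n → ℕ) where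

  restrict-∈ : ∀ {e} → P e → restrict P? f e ≡ f e
  restrict-∈ {e} Pe = cong (if_then f e else 0) (dec-true (P? e) Pe)

  restrict-∉ : ∀ {e} → ¬ P e → restrict P? f e ≡ 0
  restrict-∉ {e} ¬Pe = cong (if_then f e else 0) (dec-false (P? e) ¬Pe)

  restrict-≤ : ∀ e → restrict P? f e ℕ.≤ f e
  restrict-≤ e with does (P? e)
  ... | true  = ℕ.≤-refl
  ... | false = z≤n

  restrict-pos⇒ : ∀ {e} → 0 ℕ.< restrict P? f e → P e
  restrict-pos⇒ {e} 0<fe with P? e
  ... | yes Pe = Pe
  ... | no  _  = contradiction 0<fe λ ()

  restrict-split : ∀ e → f e ≡ restrict P? f e ℕ.+ restrict (∁? P?) f e
  restrict-split e with does (P? e)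
  ... | true  = sym (ℕ.+-identityʳ (f e))
  ... | false = refl

wsum-cong : ∀ {n} (S : Subset n) {f g : Fin n → ℕ} → (∀ i → f i ≡ g i) → wsum S f ≡ wsum S g
wsum-cong []      f≗g = refl
wsum-cong (s ∷ S) f≗g = cong₂ ℕ._+_ (cong (if s then_else 0) (f≗g Fin.zero)) (wsum-cong S (f≗g ∘ Fin.suc))

wsum-+ : ∀ {n} (S : Subset n) (f g : Fin n → ℕ) → wsum S (λ i → f i ℕ.+ g i) ≡ wsum S f ℕ.+ wsum S g
wsum-+ []          f g = refl
wsum-+ (false ∷ S) f g = wsum-+ S (f ∘ Fin.suc) (g ∘ Fin.suc)
wsum-+ (true  ∷ S) f g = begin
  (f₀ ℕ.+ g₀) ℕ.+ wsum S (λ i → f (Fin.suc i) ℕ.+ g (Fin.suc i))  ≡⟨ cong ((f₀ ℕ.+ g₀) ℕ.+_) (wsum-+ S f′ g′) ⟩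
  (f₀ ℕ.+ g₀) ℕ.+ (wsum S f′ ℕ.+ wsum S g′)                       ≡⟨ interchange f₀ g₀ (wsum S f′) (wsum S g′) ⟩
  (f₀ ℕ.+ wsum S f′) ℕ.+ (g₀ ℕ.+ wsum S g′)                       ∎
  where
  open ≡-Reasoning
  f₀ = f Fin.zero
  g₀ = g Fin.zero
  f′ = f ∘ Fin.suc
  g′ = g ∘ Fin.suc

wsum-restrict-split : ∀ {n} {P : Pred (Fin n) 0ℓ} (P? : Decidable P) (S : Subset n) f →
                      wsum S f ≡ wsum S (restrict P? f) ℕ.+ wsum S (restrict (∁? P?) f)
wsum-restrict-split P? S f = trans (wsum-cong S (restrict-split P? f)) (wsum-+ S _ _)

wsum-* : ∀ {n} (S : Subset n) k (f : Fin n → ℕ) → wsum S (λ i → k ℕ.* f i) ≡ k ℕ.* wsum S f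
wsum-* []          k f = sym (ℕ.*-zeroʳ k)
wsum-* (false ∷ S) k f = wsum-* S k (f ∘ Fin.suc)
wsum-* (true  ∷ S) k f =
  trans (cong (k ℕ.* f Fin.zero ℕ.+_) (wsum-* S k (f ∘ Fin.suc))) (sym (ℕ.*-distribˡ-+ k (f Fin.zero) _))

wsum-mono-⊆ : ∀ {n} {S T : Subset n} (f : Fin n → ℕ) → S ⊆ T → wsum S f ℕ.≤ wsum T f
wsum-mono-⊆ {S = []}        {[]}        f S⊆T = z≤n
wsum-mono-⊆ {S = false ∷ S} {false ∷ T} f S⊆T = wsum-mono-⊆ (f ∘ Fin.suc) (drop-∷-⊆ S⊆T)
wsum-mono-⊆ {S = false ∷ S} {true  ∷ T} f S⊆T =
  ℕ.≤-trans (wsum-mono-⊆ (f ∘ Fin.suc) (drop-∷-⊆ S⊆T)) (ℕ.m≤n+m _ (f Fin.zero))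
wsum-mono-⊆ {S = true  ∷ S} {true  ∷ T} f S⊆T =
  ℕ.+-monoʳ-≤ (f Fin.zero) (wsum-mono-⊆ (f ∘ Fin.suc) (drop-∷-⊆ S⊆T))
wsum-mono-⊆ {S = true  ∷ S} {false ∷ T} f S⊆T with S⊆T here
... | ()

wsum-∩ : ∀ {n} (S X : Subset n) (f : Fin n → ℕ) → wsum (S ∩ X) f ≡ wsum S (restrict (_∈? X) f)
wsum-∩ []          []          f = refl
wsum-∩ (true  ∷ S) (true  ∷ X) f = cong (f Fin.zero ℕ.+_) (wsum-∩ S X (f ∘ Fin.suc))
wsum-∩ (true  ∷ S) (false ∷ X) f = wsum-∩ S X (f ∘ Fin.suc)
wsum-∩ (false ∷ S) (_     ∷ X) f = wsum-∩ S X (f ∘ Fin.suc)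

wsum-remove : ∀ {n} {S : Subset n} {a} (f : Fin n → ℕ) → a ∈ S → wsum (S ∖ a) f ℕ.+ f a ≡ wsum S f
wsum-remove {S = true ∷ S} f here =
  trans (cong (λ S′ → wsum S′ (f ∘ Fin.suc) ℕ.+ f Fin.zero) (p─⊥≡p S)) (ℕ.+-comm _ (f Fin.zero))
wsum-remove {S = s ∷ S} f (there a∈S) =
  trans (ℕ.+-assoc (if s then f Fin.zero else 0) _ _)
        (cong ((if s then f Fin.zero else 0) ℕ.+_) (wsum-remove (f ∘ Fin.suc) a∈S))

wsum-insert : ∀ {n} {S : Subset n} {b} (f : Fin n → ℕ) → b ∉ S → wsum (S ∪ ⁅ b ⁆) f ≡ wsum S f ℕ.+ f b
wsum-insert {S = true  ∷ S} {Fin.zero}  f b∉S = ⊥-elim (b∉S here)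
wsum-insert {S = false ∷ S} {Fin.zero}  f b∉S =
  trans (cong (λ S′ → f Fin.zero ℕ.+ wsum S′ (f ∘ Fin.suc)) (∪-identityʳ S)) (ℕ.+-comm (f Fin.zero) _)
wsum-insert {S = true  ∷ S} {Fin.suc b} f b∉S =
  trans (cong (f Fin.zero ℕ.+_) (wsum-insert (f ∘ Fin.suc) (drop-not-there b∉S)))
        (sym (ℕ.+-assoc (f Fin.zero) _ _))
wsum-insert {S = false ∷ S} {Fin.suc b} f b∉S = wsum-insert (f ∘ Fin.suc) (drop-not-there b∉S)

wsum-swap : ∀ {n} {S : Subset n} {a b} (f : Fin n → ℕ) → a ∈ S → b ∉ S →
            wsum ((S ∖ a) ∪ ⁅ b ⁆) f ℕ.+ f a ≡ wsum S f ℕ.+ f b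
wsum-swap {S = S} {a} {b} f a∈S b∉S = begin
  wsum ((S ∖ a) ∪ ⁅ b ⁆) f ℕ.+ f a  ≡⟨ cong (ℕ._+ f a) (wsum-insert f (b∉S ∘ p─q⊆p S ⁅ a ⁆)) ⟩
  wsum (S ∖ a) f ℕ.+ f b ℕ.+ f a    ≡⟨ ℕ.+-assoc (wsum (S ∖ a) f) (f b) (f a) ⟩
  wsum (S ∖ a) f ℕ.+ (f b ℕ.+ f a)  ≡⟨ cong (wsum (S ∖ a) f ℕ.+_) (ℕ.+-comm (f b) (f a)) ⟩
  wsum (S ∖ a) f ℕ.+ (f a ℕ.+ f b)  ≡⟨ ℕ.+-assoc (wsum (S ∖ a) f) (f a) (f b) ⟨
  wsum (S ∖ a) f ℕ.+ f a ℕ.+ f b    ≡⟨ cong (ℕ._+ f b) (wsum-remove f a∈S) ⟩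
  wsum S f ℕ.+ f b                  ∎
  where open ≡-Reasoning

wsum-swap-≤ : ∀ {n} {S : Subset n} {a b} (f : Fin n → ℕ) → a ∈ S → b ∉ S → f b ℕ.≤ f a →
              wsum ((S ∖ a) ∪ ⁅ b ⁆) f ℕ.≤ wsum S f
wsum-swap-≤ {S = S} {a} {b} f a∈S b∉S fb≤fa = ℕ.+-cancelʳ-≤ (f a) _ _ (begin
  wsum ((S ∖ a) ∪ ⁅ b ⁆) f ℕ.+ f a  ≡⟨ wsum-swap f a∈S b∉S ⟩
  wsum S f ℕ.+ f b                  ≤⟨ ℕ.+-monoʳ-≤ (wsum S f) fb≤fa ⟩
  wsum S f ℕ.+ f a                  ∎)
  where open ℕ.≤-Reasoning

wsum-∈-≤ : ∀ {n} {S : Subset n} {a} (f : Fin n → ℕ) → a ∈ S → f a ℕ.≤ wsum S f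
wsum-∈-≤ {a = a} f a∈S = subst (f a ℕ.≤_) (wsum-remove f a∈S) (ℕ.m≤n+m (f a) _)

wsum-pos⇒∃ : ∀ {n} (S : Subset n) (f : Fin n → ℕ) → 0 ℕ.< wsum S f → ∃ λ a → a ∈ S × 0 ℕ.< f a
wsum-pos⇒∃ []          f ()
wsum-pos⇒∃ (false ∷ S) f 0<ΣSf with wsum-pos⇒∃ S (f ∘ Fin.suc) 0<ΣSf
... | a , a∈S , 0<fa = Fin.suc a , there a∈S , 0<fa
wsum-pos⇒∃ (true  ∷ S) f 0<ΣSf with f Fin.zero in f0≡
... | suc _ = Fin.zero , here , subst (0 ℕ.<_) (sym f0≡) (s≤s z≤n)
... | zero with wsum-pos⇒∃ S (f ∘ Fin.suc) 0<ΣSf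
...   | a , a∈S , 0<fa = Fin.suc a , there a∈S , 0<fa

wsum≤∣S∣*β : ∀ {n} (S : Subset n) (f : Fin n → ℕ) {β} → (∀ {i} → i ∈ S → toℚ (f i) ≤ β) →
             toℚ (wsum S f) ≤ toℚ ∣ S ∣ * β
wsum≤∣S∣*β []          f {β} bound = ≤-reflexive (sym (*-zeroˡ β))
wsum≤∣S∣*β (false ∷ S) f     bound = wsum≤∣S∣*β S (f ∘ Fin.suc) (bound ∘ there)
wsum≤∣S∣*β (true  ∷ S) f {β} bound = begin
  toℚ (f Fin.zero ℕ.+ wsum S f′)    ≡⟨ toℚ-+ (f Fin.zero) _ ⟩
  toℚ (f Fin.zero) + toℚ (wsum S f′) ≤⟨ +-mono-≤ (bound here) (wsum≤∣S∣*β S f′ (bound ∘ there)) ⟩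
  β + toℚ ∣ S ∣ * β                  ≡⟨ cong (_+ toℚ ∣ S ∣ * β) (*-identityˡ β) ⟨
  1ℚ * β + toℚ ∣ S ∣ * β             ≡⟨ *-distribʳ-+ β 1ℚ (toℚ ∣ S ∣) ⟨
  (1ℚ + toℚ ∣ S ∣) * β               ≡⟨ cong (_* β) (toℚ-+ 1 ∣ S ∣) ⟨
  toℚ (suc ∣ S ∣) * β                ∎
  where
  open ≤-Reasoning
  f′ = f ∘ Fin.suc

module _ {A : Set} (Good : A → Set) (μ : A → ℕ)
         (improve : ∀ {x} → Good x → 0 ℕ.< μ x → ∃ λ y → Good y × μ y ℕ.< μ x) where

  descend-to-zero : ∀ {x} → Good x → ∃ λ y → Good y × μ y ≡ 0
  descend-to-zero {x} good = <-rec Descends step (μ x) good refl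
    where
    Descends : ℕ → Set
    Descends m = ∀ {x} → Good x → μ x ≡ m → ∃ λ y → Good y × μ y ≡ 0
    step : ∀ m → (∀ {m′} → m′ ℕ.< m → Descends m′) → Descends m
    step zero    _   {x} good μx≡0   = x , good , μx≡0
    step (suc m) rec     good μx≡1+m with improve good (subst (0 ℕ.<_) (sym μx≡1+m) z<s)
    ... | y , good′ , μy<μx = rec (subst (μ y ℕ.<_) μx≡1+m μy<μx) good′ refl

module _ {n} (I : BM n) where
  open BM I

  solution-⊆ : ∀ {S Δ} → S ⊆ Δ → IsSolution Δ → IsSolution S
  solution-⊆ {S} {Δ} S⊆Δ ((feasible , ∣Δ∣≤k) , cΔ≤B) =
    ( (λ i → Matroid.indep-↓ (Matchoid.mat M i) ∩-monoˡ (feasible i))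
    , ℕ.≤-trans (p⊆q⇒∣p∣≤∣q∣ S⊆Δ) ∣Δ∣≤k )
    , ℕ.≤-trans (wsum-mono-⊆ c S⊆Δ) cΔ≤B
    where
    ∩-monoˡ : ∀ {X} → S ∩ X ⊆ Δ ∩ X
    ∩-monoˡ {X} x∈S∩X with x∈p∩q⁻ S X x∈S∩X
    ... | x∈S , x∈X = x∈p∩q⁺ (S⊆Δ x∈S , x∈X)

module ExchangeArgument {n} (I : BM n) (ε α : ℚ) (o : ℕ) (R : Subset n)
  (optimal : ∀ S → BM.IsSolution I S → wsum S (BM.p I) ℕ.≤ o)
  (0<ε : 0ℚ < ε) (0<1-ε : 0ℚ < 1ℚ - ε)
  (o≤2ℓα : toℚ o ≤ toℚ (2 ℕ.* BM.ℓ I) * α) (α≤o : α ≤ toℚ o)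
  (exchange : ∀ r → BM.InD I ε r → BM.IsExchangeSet I ε α r (λ e → (e ∈ R) × BM.InK I ε α r e))
  where

  open BM I

  q : ℚ
  q = 1ℚ - ε

  L : ℚ
  L = toℚ (2 ℕ.* ℓ) * α

  Big : Pred (Fin n) 0ℓ
  Big e = ε * α < toℚ (k ℕ.* p e)

  big? : Decidable Big
  big? e = ε * α <? toℚ (k ℕ.* p e)

  pR pR̄ pBig pSmall : Fin n → ℕ
  pR = restrict (_∈? R) p
  pR̄ = restrict (∁? (_∈? R)) p
  pBig = restrict big? pR̄
  pSmall = restrict (∁? big?) pR̄

  Φ : Subset n → ℚ
  Φ Δ = toℚ (wsum Δ pR) + q * toℚ (wsum Δ pBig)

  0≤α : 0ℚ ≤ α
  0≤α = *-cancelˡ-≤-pos (toℚ (2 ℕ.* ℓ)) {{positive (toℚ-mono-< (ℕ.*-monoʳ-< 2 ℓ-pos))}}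
    (≤-trans (≤-reflexive (*-zeroʳ (toℚ (2 ℕ.* ℓ)))) (≤-trans (toℚ-nonNeg o) o≤2ℓα))

  L≤2ℓo : L ≤ toℚ (2 ℕ.* ℓ ℕ.* o)
  L≤2ℓo = ≤-trans (*-monoˡ-≤-nonNeg (toℚ (2 ℕ.* ℓ)) {{nonNegative (toℚ-nonNeg (2 ℕ.* ℓ))}} α≤o)
                  (≤-reflexive (sym (toℚ-* (2 ℕ.* ℓ) o)))

  -- InK r is stated with (1 - ε) ^ℚ (r ∸ 1), so a class index is written suc r throughout.
  member⇒InK : ∀ {Δ a} → IsSolution Δ → a ∈ Δ → ∃ λ r → InK ε α (suc r) a
  member⇒InK {Δ} {a} solΔ a∈Δ = bracket (∃[1-ε]^n*x<1 (2 ℕ.* ℓ ℕ.* o) 0<ε 0<1-ε L≤2ℓo)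
    where
    pa≤L : toℚ (p a) ≤ L
    pa≤L = ≤-trans (toℚ-mono-≤ (ℕ.≤-trans (wsum-∈-≤ p a∈Δ) (optimal Δ solΔ))) o≤2ℓα
    bracket : (∃ λ N → q ^ℚ N * L < 1ℚ) → ∃ λ r → InK ε α (suc r) a
    bracket (N , qᴺL<1) = power-bracket q N (<-≤-trans qᴺL<1 (toℚ-mono-≤ {1} (p-pos a))) pa≤L

  Big⇒InD : ∀ {a} r → Big a → InK ε α (suc r) a → InD ε (suc r)
  Big⇒InD {a} r εα<kpa (_ , pa≤qʳL) =
    z<s , <⇒≤ (*-cancelʳ-<-nonNeg α {{nonNegative 0≤α}} (begin-strict
      ε * α                                   <⟨ εα<kpa ⟩
      toℚ (k ℕ.* p a)                         ≡⟨ toℚ-* k (p a) ⟩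
      toℚ k * toℚ (p a)                       ≤⟨ *-monoˡ-≤-nonNeg (toℚ k) {{nonNegative (toℚ-nonNeg k)}} pa≤qʳL ⟩
      toℚ k * (q ^ℚ r * (toℚ (2 ℕ.* ℓ) * α))  ≡⟨ regroup (toℚ k) (q ^ℚ r) (toℚ (2 ℕ.* ℓ)) α ⟩
      toℚ (2 ℕ.* ℓ) * toℚ k * q ^ℚ r * α      ≡⟨ cong (λ x → x * q ^ℚ r * α) (toℚ-* (2 ℕ.* ℓ) k) ⟨
      toℚ (2 ℕ.* ℓ ℕ.* k) * q ^ℚ r * α        ∎))
    where
    open ≤-Reasoning
    open +-*-Solver
    regroup : ∀ k Q t α → k * (Q * (t * α)) ≡ t * k * Q * α
    regroup = solve 4 (λ k Q t α → k :* (Q :* (t :* α)) := t :* k :* Q :* α) refl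

  InK⇒q*pa≤pb : ∀ {a b} r → InK ε α (suc r) a → InK ε α (suc r) b → q * toℚ (p a) ≤ toℚ (p b)
  InK⇒q*pa≤pb {a} {b} r (_ , pa≤qʳL) (qʳ⁺¹L<pb , _) = begin
    q * toℚ (p a)     ≤⟨ *-monoˡ-≤-nonNeg q {{nonNegative (<⇒≤ 0<1-ε)}} pa≤qʳL ⟩
    q * (q ^ℚ r * L)  ≡⟨ *-assoc q (q ^ℚ r) L ⟨
    q ^ℚ suc r * L    ≤⟨ <⇒≤ qʳ⁺¹L<pb ⟩
    toℚ (p b)         ∎
    where open ≤-Reasoning

  swap-improves : ∀ {Δ a b} r → IsSolution Δ → a ∈ Δ → a ∉ R → Big a → InK ε α (suc r) a →
                  InK ε α (suc r) b → b ∈ R → b ∉ Δ → c b ℕ.≤ c a → InMk ((Δ ∖ a) ∪ ⁅ b ⁆) →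
                  (IsSolution ((Δ ∖ a) ∪ ⁅ b ⁆) × Φ Δ ≤ Φ ((Δ ∖ a) ∪ ⁅ b ⁆)) ×
                  wsum ((Δ ∖ a) ∪ ⁅ b ⁆) pBig ℕ.< wsum Δ pBig
  swap-improves {Δ} {a} {b} r (_ , cΔ≤B) a∈Δ a∉R big-a a∈K b∈K b∈R b∉Δ cb≤ca Δ′∈Mk =
    (solΔ′ , ΦΔ≤ΦΔ′) , wBig′<wBig
    where
    Δ′ = (Δ ∖ a) ∪ ⁅ b ⁆
    wR = wsum Δ pR
    wBig = wsum Δ pBig
    wBig′ = wsum Δ′ pBig
    solΔ′ : IsSolution Δ′
    solΔ′ = Δ′∈Mk , ℕ.≤-trans (wsum-swap-≤ c a∈Δ b∉Δ cb≤ca) cΔ≤B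
    gain-R : wsum Δ′ pR ≡ wR ℕ.+ p b
    gain-R = begin
      wsum Δ′ pR           ≡⟨ ℕ.+-identityʳ _ ⟨
      wsum Δ′ pR ℕ.+ 0     ≡⟨ cong (wsum Δ′ pR ℕ.+_) (restrict-∉ (_∈? R) p a∉R) ⟨
      wsum Δ′ pR ℕ.+ pR a  ≡⟨ wsum-swap pR a∈Δ b∉Δ ⟩
      wR ℕ.+ pR b          ≡⟨ cong (wR ℕ.+_) (restrict-∈ (_∈? R) p b∈R) ⟩
      wR ℕ.+ p b           ∎
      where open ≡-Reasoning
    pBig-b≡0 : pBig b ≡ 0
    pBig-b≡0 = ℕ.n≤0⇒n≡0 (ℕ.≤-trans (restrict-≤ big? pR̄ b)
                                    (ℕ.≤-reflexive (restrict-∉ (∁? (_∈? R)) p (λ b∉R → b∉R b∈R))))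
    loss-big : wBig′ ℕ.+ p a ≡ wBig
    loss-big = begin
      wBig′ ℕ.+ p a     ≡⟨ cong (wBig′ ℕ.+_) (restrict-∈ (∁? (_∈? R)) p a∉R) ⟨
      wBig′ ℕ.+ pR̄ a    ≡⟨ cong (wBig′ ℕ.+_) (restrict-∈ big? pR̄ big-a) ⟨
      wBig′ ℕ.+ pBig a  ≡⟨ wsum-swap pBig a∈Δ b∉Δ ⟩
      wBig ℕ.+ pBig b   ≡⟨ cong (wBig ℕ.+_) pBig-b≡0 ⟩
      wBig ℕ.+ 0        ≡⟨ ℕ.+-identityʳ _ ⟩
      wBig              ∎
      where open ≡-Reasoning
    ΦΔ≤ΦΔ′ : Φ Δ ≤ Φ Δ′
    ΦΔ≤ΦΔ′ = begin
      toℚ wR + q * toℚ wBig                  ≡⟨ cong (λ x → toℚ wR + q * toℚ x) loss-big ⟨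
      toℚ wR + q * toℚ (wBig′ ℕ.+ p a)       ≡⟨ cong (λ x → toℚ wR + q * x) (toℚ-+ wBig′ (p a)) ⟩
      toℚ wR + q * (toℚ wBig′ + toℚ (p a))   ≤⟨ a+q[b+x]≤[a+y]+qb (toℚ wR) (toℚ wBig′) q (InK⇒q*pa≤pb r a∈K b∈K) ⟩
      (toℚ wR + toℚ (p b)) + q * toℚ wBig′   ≡⟨ cong (_+ q * toℚ wBig′) (toℚ-+ wR (p b)) ⟨
      toℚ (wR ℕ.+ p b) + q * toℚ wBig′       ≡⟨ cong (λ x → toℚ x + q * toℚ wBig′) gain-R ⟨
      Φ Δ′                                   ∎
      where open ≤-Reasoning
    wBig′<wBig : wBig′ ℕ.< wBig
    wBig′<wBig = subst (wBig′ ℕ.<_) loss-big (ℕ.m<m+n wBig′ (p-pos a))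

  exchange-step : ∀ {Δ a} → IsSolution Δ → a ∈ Δ → a ∉ R → Big a →
                  ∃ λ Δ′ → (IsSolution Δ′ × Φ Δ ≤ Φ Δ′) × wsum Δ′ pBig ℕ.< wsum Δ pBig
  exchange-step {Δ} {a} solΔ a∈Δ a∉R big-a =
    let r , a∈K = member⇒InK solΔ a∈Δ
        b , b∈K , (b∈R , _) , b∉Δ , cb≤ca , Δ′∈Mk =
          proj₂ (exchange (suc r) (Big⇒InD r big-a a∈K)) Δ (proj₁ solΔ) a a∈Δ a∈K (a∉R ∘ proj₁)
    in  (Δ ∖ a) ∪ ⁅ b ⁆ , swap-improves r solΔ a∈Δ a∉R big-a a∈K b∈K b∈R b∉Δ cb≤ca Δ′∈Mk

  SolutionAbove : ℚ → Subset n → Set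
  SolutionAbove Φ₀ Δ = IsSolution Δ × Φ₀ ≤ Φ Δ

  exchange-away-big : ∀ {S} → IsSolution S → ∃ λ Δ → SolutionAbove (Φ S) Δ × wsum Δ pBig ≡ 0
  exchange-away-big {S} solS =
    descend-to-zero (SolutionAbove (Φ S)) (λ Δ → wsum Δ pBig) improve (solS , ≤-refl)
    where
    improve : ∀ {Δ} → SolutionAbove (Φ S) Δ → 0 ℕ.< wsum Δ pBig →
              ∃ λ Δ′ → SolutionAbove (Φ S) Δ′ × wsum Δ′ pBig ℕ.< wsum Δ pBig
    improve {Δ} (solΔ , ΦS≤ΦΔ) 0<wBig =
      let a , a∈Δ , 0<pBig-a = wsum-pos⇒∃ Δ pBig 0<wBig
          a∉R = restrict-pos⇒ (∁? (_∈? R)) p (ℕ.<-≤-trans 0<pBig-a (restrict-≤ big? pR̄ a))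
          Δ′ , (solΔ′ , ΦΔ≤ΦΔ′) , wBig′<wBig = exchange-step solΔ a∈Δ a∉R (restrict-pos⇒ big? pR̄ 0<pBig-a)
      in  Δ′ , (solΔ′ , ≤-trans ΦS≤ΦΔ ΦΔ≤ΦΔ′) , wBig′<wBig

  Φ≡wsum-∩R : ∀ Δ → wsum Δ pBig ≡ 0 → Φ Δ ≡ toℚ (wsum (Δ ∩ R) p)
  Φ≡wsum-∩R Δ wBig≡0 = begin
    toℚ (wsum Δ pR) + q * toℚ (wsum Δ pBig)  ≡⟨ cong (λ x → toℚ (wsum Δ pR) + q * toℚ x) wBig≡0 ⟩
    toℚ (wsum Δ pR) + q * 0ℚ                 ≡⟨ cong (λ x → toℚ (wsum Δ pR) + x) (*-zeroʳ q) ⟩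
    toℚ (wsum Δ pR) + 0ℚ                     ≡⟨ +-identityʳ _ ⟩
    toℚ (wsum Δ pR)                          ≡⟨ cong toℚ (wsum-∩ Δ R p) ⟨
    toℚ (wsum (Δ ∩ R) p)                     ∎
    where open ≡-Reasoning

  wsum-p-split : ∀ S → wsum S p ≡ wsum S pR ℕ.+ wsum S pBig ℕ.+ wsum S pSmall
  wsum-p-split S = begin
    wsum S p                                         ≡⟨ wsum-restrict-split (_∈? R) S p ⟩
    wsum S pR ℕ.+ wsum S pR̄                          ≡⟨ cong (wsum S pR ℕ.+_) (wsum-restrict-split big? S pR̄) ⟩
    wsum S pR ℕ.+ (wsum S pBig ℕ.+ wsum S pSmall)    ≡⟨ ℕ.+-assoc (wsum S pR) _ _ ⟨
    wsum S pR ℕ.+ wsum S pBig ℕ.+ wsum S pSmall      ∎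
    where open ≡-Reasoning

  0≤εα : 0ℚ ≤ ε * α
  0≤εα = nonNeg*nonNeg (<⇒≤ 0<ε) 0≤α

  k*pSmall≤εα : ∀ e → toℚ (k ℕ.* pSmall e) ≤ ε * α
  k*pSmall≤εα e = ≮⇒≥ λ εα<kpSmall →
    <-irrefl refl (<-≤-trans εα<kpSmall (subst (λ x → toℚ x ≤ ε * α) (sym (kpSmall≡0 εα<kpSmall)) 0≤εα))
    where
    kpSmall≡0 : ε * α < toℚ (k ℕ.* pSmall e) → k ℕ.* pSmall e ≡ 0
    kpSmall≡0 εα<kpSmall = trans (cong (k ℕ.*_) (restrict-∉ (∁? big?) pR̄ λ ¬big → ¬big big-e)) (ℕ.*-zeroʳ k)
      where
      pSmall≤p : pSmall e ℕ.≤ p e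
      pSmall≤p = ℕ.≤-trans (restrict-≤ (∁? big?) pR̄ e) (restrict-≤ (∁? (_∈? R)) p e)
      big-e : Big e
      big-e = <-≤-trans εα<kpSmall (toℚ-mono-≤ (ℕ.*-monoʳ-≤ k pSmall≤p))

  wsum-pSmall≤εα : ∀ {S} → IsSolution S → toℚ (wsum S pSmall) ≤ ε * α
  wsum-pSmall≤εα {S} ((_ , ∣S∣≤k) , _) = *-cancelˡ-≤-pos (toℚ k) {{positive (toℚ-mono-< k-pos)}} (begin
    toℚ k * toℚ (wsum S pSmall)          ≡⟨ toℚ-* k _ ⟨
    toℚ (k ℕ.* wsum S pSmall)            ≡⟨ cong toℚ (wsum-* S k pSmall) ⟨
    toℚ (wsum S (λ e → k ℕ.* pSmall e))  ≤⟨ wsum≤∣S∣*β S _ (λ {e} _ → k*pSmall≤εα e) ⟩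
    toℚ ∣ S ∣ * (ε * α)                  ≤⟨ *-monoʳ-≤-nonNeg (ε * α) {{nonNegative 0≤εα}} (toℚ-mono-≤ ∣S∣≤k) ⟩
    toℚ k * (ε * α)                      ∎)
    where open ≤-Reasoning

  [1-2ε]o≤Φ : ∀ {S} → IsSolution S → wsum S p ≡ o → (1ℚ - toℚ 2 * ε) * toℚ o ≤ Φ S
  [1-2ε]o≤Φ {S} solS wS≡o = begin
    (1ℚ - toℚ 2 * ε) * toℚ o                           ≡⟨ cong ((1ℚ - toℚ 2 * ε) *_) o≡R+Big+Small ⟩
    (1ℚ - toℚ 2 * ε) * (toℚ wR + toℚ wBig + toℚ wSmall)  ≤⟨ [1-2ε][A+B+C]≤A+[1-ε]B (<⇒≤ 0<ε)
                                                            (toℚ-nonNeg wR) (toℚ-nonNeg wSmall) Small≤ε[R+Big+Small] ⟩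
    toℚ wR + q * toℚ wBig                              ∎
    where
    open ≤-Reasoning
    wR = wsum S pR
    wBig = wsum S pBig
    wSmall = wsum S pSmall
    o≡R+Big+Small : toℚ o ≡ toℚ wR + toℚ wBig + toℚ wSmall
    o≡R+Big+Small = begin-equality
      toℚ o                           ≡⟨ cong toℚ (trans (sym wS≡o) (wsum-p-split S)) ⟩
      toℚ (wR ℕ.+ wBig ℕ.+ wSmall)    ≡⟨ toℚ-+ (wR ℕ.+ wBig) wSmall ⟩
      toℚ (wR ℕ.+ wBig) + toℚ wSmall  ≡⟨ cong (_+ toℚ wSmall) (toℚ-+ wR wBig) ⟩
      toℚ wR + toℚ wBig + toℚ wSmall  ∎
    Small≤ε[R+Big+Small] : toℚ wSmall ≤ ε * (toℚ wR + toℚ wBig + toℚ wSmall)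
    Small≤ε[R+Big+Small] = begin
      toℚ wSmall                            ≤⟨ wsum-pSmall≤εα solS ⟩
      ε * α                                 ≤⟨ *-monoˡ-≤-nonNeg ε {{nonNegative (<⇒≤ 0<ε)}} α≤o ⟩
      ε * toℚ o                             ≡⟨ cong (ε *_) o≡R+Big+Small ⟩
      ε * (toℚ wR + toℚ wBig + toℚ wSmall)  ∎

lemma2p5 : ∀ {n} (I : BM n) (ε α : ℚ) (o : ℕ) (R : Subset n) →
    BM.IsOPT I o →
    0ℚ < ε → ε < ½ →
    toℚ o ≤ toℚ (2 Data.Nat.* BM.ℓ I) * α → α ≤ toℚ o →
    (∀ r → BM.InD I ε r → BM.IsExchangeSet I ε α r (λ e → (e ∈ R) × BM.InK I ε α r e)) →
    BM.IsRepresentative I o ε R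
lemma2p5 I ε α o R ((S* , solS* , wS*≡o) , optimal) 0<ε ε<½ o≤2ℓα α≤o exchange =
  let Δ , (solΔ , ΦS*≤ΦΔ) , wBigΔ≡0 = exchange-away-big solS*
  in  Δ ∩ R , solution-⊆ I (p∩q⊆p Δ R) solΔ , p∩q⊆q Δ R , (begin
        (1ℚ - toℚ 2 * ε) * toℚ o     ≤⟨ [1-2ε]o≤Φ solS* wS*≡o ⟩
        Φ S*                         ≤⟨ ΦS*≤ΦΔ ⟩
        Φ Δ                          ≡⟨ Φ≡wsum-∩R Δ wBigΔ≡0 ⟩
        toℚ (wsum (Δ ∩ R) (BM.p I))  ∎)
  where
  open ≤-Reasoning
  open ExchangeArgument I ε α o R optimal 0<ε (p<1⇒0<1-p (<-trans ε<½ ½<1)) o≤2ℓα α≤o exchange
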